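{- Let $\Gamma$ be a finite simple graph. (i) The join of any two sibling partitions of $V\Gamma$ is a sibling partition. (ii) There is a unique maximal sibling partition of $V\Gamma$ (maximal with respect to the coarser-than order), and it is the partition produced by complete twin reduction on $\Gamma$, namely the partition reached when the following process terminates: start with the partition $\Pi$ of $V\Gamma$ into singletons; while the quotient graph $\Gamma/\Pi$ contains a pair of twins, merge the two corresponding parts of $\Pi$ into a single part; stop when $\Gamma/\Pi$ has no twins.
   Context: All graphs are finite and simple; $\Gamma(v)$ denotes the set of neighbours of a vertex $v$. Two distinct vertices $v,w$ of a graph are twins if $\Gamma(v)\setminus\{w\}=\Gamma(w)\setminus\{v\}$. For a partition $\Pi$ of $V\Gamma$, the quotient graph $\Gamma/\Pi$ has the parts of $\Pi$ as vertices, two distinct parts being adjacent when there is an edge of $\Gamma$ between them. A cograph is a graph with no induced path on four vertices. A sibling partition of $\Gamma$ is a partition of $V\Gamma$ such that (a) the induced subgraph on each part is a cograph, and (b) between any two distinct parts there are either no edges or all possible edges. A partition $\Pi_1$ is finer than $\Pi_2$ ($\Pi_2$ coarser than $\Pi_1$) if every part of $\Pi_1$ is contained in a part of $\Pi_2$. The join $\Pi_1\vee\Pi_2$ of two partitions of a set $V$ is the partition whose parts are the connected components of the graph on $V$ whose edges are the pairs contained in a part of $\Pi_1$ or in a part of $\Pi_2$; it is the finest partition coarser than both. -}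

module Defs where

open import Level using (0ℓ)
open import Data.Nat using (ℕ)
open import Data.Fin using (Fin)
open import Data.Product using (Σ; Σ-syntax; ∃; ∃-syntax; _×_; _,_)
open import Data.Sum using (_⊎_)
open import Relation.Nullary using (¬_)
open import Relation.Binary.Core using (Rel)
open import Relation.Binary.Definitions using (Symmetric; Decidable)
open import Relation.Binary.Structures using (IsEquivalence)
open import Relation.Binary.PropositionalEquality using (_≡_)
open import Relation.Binary.Construct.Closure.Equivalence using (EqClosure)
open import Relation.Binary.Construct.Closure.ReflexiveTransitive using (Star)

record Graph (n : ℕ) : Set₁ where
  field
    E      : Rel (Fin n) 0ℓ
    sym    : Symmetric E
    irrefl : ∀ v → ¬ E v v
    dec    : Decidable E
open Graph public

-- A partition of Fin n, represented by its relation "in the same part".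
PRel : ℕ → Set₁
PRel n = Rel (Fin n) 0ℓ

IsPartition : ∀ {n} → PRel n → Set
IsPartition Π = IsEquivalence Π × Decidable Π

_⊑_ : ∀ {n} → PRel n → PRel n → Set
Π₁ ⊑ Π₂ = ∀ x y → Π₁ x y → Π₂ x y

_≐_ : ∀ {n} → PRel n → PRel n → Set
Π₁ ≐ Π₂ = (Π₁ ⊑ Π₂) × (Π₂ ⊑ Π₁)

Join : ∀ {n} → PRel n → PRel n → PRel n
Join Π₁ Π₂ = EqClosure (λ x y → Π₁ x y ⊎ Π₂ x y)

-- a - b - c - d is an induced path on four vertices of Γ.
-- (Distinctness of a,b,c,d is forced by the edge/non-edge conditions.)
InducedP4 : ∀ {n} → Graph n → Fin n → Fin n → Fin n → Fin n → Set
InducedP4 Γ a b c d =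
  E Γ a b × E Γ b c × E Γ c d × ¬ E Γ a c × ¬ E Γ b d × ¬ E Γ a d

-- Sibling partition: (a) each part induces a cograph, (b) between two
-- distinct parts there are no edges or all edges.
Sibling : ∀ {n} → Graph n → PRel n → Set
Sibling Γ Π =
  (∀ a b c d → Π a b → Π a c → Π a d → ¬ InducedP4 Γ a b c d)
  × (∀ x y x' y' → Π x x' → Π y y' → ¬ Π x y → E Γ x y → E Γ x' y')

MaximalSibling : ∀ {n} → Graph n → PRel n → Set₁
MaximalSibling Γ Π =
  Sibling Γ Π × (∀ Σ' → IsPartition Σ' → Sibling Γ Σ' → Π ⊑ Σ' → Σ' ⊑ Π)

-- Adjacency in the quotient graph Γ/Π between the parts of x and z
-- (only used for distinct parts).
QAdj : ∀ {n} → Graph n → PRel n → Fin n → Fin n → Set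
QAdj Γ Π x z = ∃[ x' ] ∃[ z' ] (Π x x' × Π z z' × E Γ x' z')

QTwins : ∀ {n} → Graph n → PRel n → Fin n → Fin n → Set
QTwins Γ Π x y =
  ¬ Π x y ×
  (∀ z → ¬ Π z x → ¬ Π z y → (QAdj Γ Π z x → QAdj Γ Π z y) × (QAdj Γ Π z y → QAdj Γ Π z x))

Merge : ∀ {n} → PRel n → Fin n → Fin n → PRel n
Merge Π x y a b = Π a b ⊎ (Π a x × Π b y) ⊎ (Π a y × Π b x)

TRStep : ∀ {n} → Graph n → PRel n → PRel n → Set
TRStep Γ Π Π' = ∃[ x ] ∃[ y ] (QTwins Γ Π x y × (Π' ≐ Merge Π x y))

Reachable : ∀ {n} → Graph n → PRel n → Set₁
Reachable Γ Π = Star (TRStep Γ) _≡_ Π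

TwinFree : ∀ {n} → Graph n → PRel n → Set
TwinFree Γ Π = ∀ x y → ¬ QTwins Γ Π x y

module Submission where

-- A partition is sibling iff its parts are P4-free modules, and a module containing two
-- vertices of an induced P4 contains all four. (i) Walking along a chain of parts of Π₁
-- and Π₂ from a vertex a of an induced P4, the union of the parts met so far stays a
-- module whose only vertex on the P4 is a, so the other vertices are never reached.
-- (ii) The union of two twin parts of Γ/Π is a module and a union of two P4-free modules
-- is P4-free, so merging twins keeps the partition sibling; it also lowers the number of
-- pairs of vertices in different parts, hence twin reduction terminates, in a twin-free
-- sibling partition S. If some sibling partition T had a part P meeting two classes of S,
-- these classes would form a cograph on at least two vertices; by Seinsche's theorem it or
-- its complement is disconnected, so by induction it has twins, and since P is a module
-- they would be twins of Γ/S. Thus S is coarser than every sibling partition, which gives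
-- maximality and both uniqueness statements.

open import Defs
open import Data.Product using (Σ; Σ-syntax; _×_)

open import Level using (0ℓ)
open import Data.Nat using (ℕ; _<_; _≤_; z≤n; s≤s)
open import Data.Nat.Properties using (m≤n⇒m≤1+n)
open import Data.Nat.Induction using (<-wellFounded)
open import Data.List using ([]; _∷_; length; filter; allFin; cartesianProduct)
open import Data.List.Membership.Propositional using (_∈_)
open import Data.List.Membership.Propositional.Properties using (∈-allFin; ∈-cartesianProduct⁺)
open import Data.List.Relation.Unary.Any using (here; there)
open import Data.Fin using (Fin; _≟_)
open import Data.Fin.Properties using (any?; all?)
open import Data.Product using (∃; ∃-syntax; _,_; proj₁; proj₂; map)
open import Data.Sum using (_⊎_; inj₁; inj₂; swap; map₂; fromInj₁; fromInj₂)
open import Data.Empty using (⊥; ⊥-elim)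
open import Function using (_∘_)
open import Induction.WellFounded using (Acc; acc)
open import Relation.Nullary using (¬_; Dec; yes; no; contradiction)
open import Relation.Nullary.Decidable
  using (_×-dec_; _⊎-dec_; _→-dec_; ¬?; map′; toSum; decidable-stable)
open import Relation.Unary using (Pred; _∪_)
open import Relation.Binary.Core using (Rel)
open import Relation.Binary.Definitions using (Reflexive; Symmetric; Decidable)
open import Relation.Binary.Structures using (IsEquivalence)
open import Relation.Binary.PropositionalEquality using (_≡_; _≢_; refl; isEquivalence)
open import Relation.Binary.Construct.Closure.Symmetric using (SymClosure; fwd; bwd)
open import Relation.Binary.Construct.Closure.ReflexiveTransitive
  using (Star; ε; _◅_; _◅◅_; return)
import Relation.Binary.Construct.Closure.Equivalence as EqClosure

module _ {A : Set} {P Q : A → Set} (P? : ∀ x → Dec (P x)) (Q? : ∀ x → Dec (Q x))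
         (P⊆Q : ∀ {x} → P x → Q x) where

  filter-length-mono : ∀ xs → length (filter P? xs) ≤ length (filter Q? xs)
  filter-length-mono [] = z≤n
  filter-length-mono (x ∷ xs) with P? x | Q? x
  ... | yes _ | yes _  = s≤s (filter-length-mono xs)
  ... | yes p | no ¬q  = contradiction (P⊆Q p) ¬q
  ... | no _  | yes _  = m≤n⇒m≤1+n (filter-length-mono xs)
  ... | no _  | no _   = filter-length-mono xs

  filter-length-< : ∀ {z xs} → z ∈ xs → Q z → ¬ P z →
                    length (filter P? xs) < length (filter Q? xs)
  filter-length-< {xs = x ∷ xs} (here refl) qz ¬pz with P? x | Q? x
  ... | yes pz | _     = contradiction pz ¬pz
  ... | no _   | yes _ = s≤s (filter-length-mono xs)
  ... | no _   | no ¬q = contradiction qz ¬q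
  filter-length-< {xs = x ∷ xs} (there z∈xs) qz ¬pz with P? x | Q? x
  ... | yes _ | yes _ = s≤s (filter-length-< z∈xs qz ¬pz)
  ... | yes p | no ¬q = contradiction (P⊆Q p) ¬q
  ... | no _  | yes _ = m≤n⇒m≤1+n (filter-length-< z∈xs qz ¬pz)
  ... | no _  | no _  = filter-length-< z∈xs qz ¬pz

disjunctive-syllogism : ∀ {A B : Set} → A ⊎ B → ¬ A → B
disjunctive-syllogism a⊎b ¬a = fromInj₂ (λ a → contradiction a ¬a) a⊎b

Homogeneous : ∀ {n} → Rel (Fin n) 0ℓ → PRel n → Set
Homogeneous _~_ Π = ∀ x y x′ y′ → Π x x′ → Π y y′ → ¬ Π x y → x ~ y → x′ ~ y′

module _ {n : ℕ} (Γ : Graph n) where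

  Module : Pred (Fin n) 0ℓ → Set
  Module U = ∀ {v y z} → U y → U z → ¬ U v → E Γ v y → E Γ v z

  P4Free : Pred (Fin n) 0ℓ → Set
  P4Free U = ∀ {a b c d} → U a → U b → U c → U d → ¬ InducedP4 Γ a b c d

  P4FreeParts : PRel n → Set
  P4FreeParts Π = ∀ a b c d → Π a b → Π a c → Π a d → ¬ InducedP4 Γ a b c d

  ModularParts : PRel n → Set
  ModularParts Π = ∀ {p p′ v} → Π p p′ → ¬ Π p v → E Γ v p → E Γ v p′

  module _ {U : Pred (Fin n) 0ℓ} (U-module : Module U) where

    module-absorbs : ∀ {v y z} → U y → U z → E Γ v y → ¬ E Γ v z → ¬ ¬ U v
    module-absorbs uy uz vy ¬vz ¬uv = ¬vz (U-module uy uz ¬uv vy)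

    module-∋-middle⇒ends : ∀ {a b c d} → InducedP4 Γ a b c d → U b → U c → ¬ ¬ (U a × U d)
    module-∋-middle⇒ends (ab , bc , cd , ¬ac , ¬bd , ¬ad) ub uc k =
      module-absorbs ub uc ab ¬ac λ ua →
      module-absorbs uc ub (sym Γ cd) (¬bd ∘ sym Γ) λ ud → k (ua , ud)

    module-∋-end⇒middle : ∀ {a b c d} → InducedP4 Γ a b c d →
                          U a → U b ⊎ U c ⊎ U d → ¬ ¬ (U b × U c)
    module-∋-end⇒middle (ab , bc , cd , ¬ac , ¬bd , ¬ad) ua (inj₁ ub) k =
      module-absorbs ub ua (sym Γ bc) (¬ac ∘ sym Γ) λ uc → k (ub , uc)
    module-∋-end⇒middle (ab , bc , cd , ¬ac , ¬bd , ¬ad) ua (inj₂ (inj₁ uc)) k =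
      module-absorbs uc ua (sym Γ cd) (¬ad ∘ sym Γ) λ ud →
      module-absorbs ua ud (sym Γ ab) ¬bd λ ub → k (ub , uc)
    module-∋-end⇒middle (ab , bc , cd , ¬ac , ¬bd , ¬ad) ua (inj₂ (inj₂ ud)) k =
      module-absorbs ua ud (sym Γ ab) ¬bd λ ub →
      module-absorbs ud ua cd (¬ac ∘ sym Γ) λ uc → k (ub , uc)

    module _ (U-P4Free : P4Free U) where

      P4Free-module-∌-middle : ∀ {a b c d} → InducedP4 Γ a b c d → ¬ (U b × U c)
      P4Free-module-∌-middle p (ub , uc) =
        module-∋-middle⇒ends p ub uc λ (ua , ud) → U-P4Free ua ub uc ud p

      P4Free-module-∋-end⇒∌-rest : ∀ {a b c d} → InducedP4 Γ a b c d →
                                    U a → ¬ (U b ⊎ U c ⊎ U d)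
      P4Free-module-∋-end⇒∌-rest p ua rest =
        module-∋-end⇒middle p ua rest (P4Free-module-∌-middle p)

  ∪-module : ∀ {U K x} → Module U → Module K → U x → K x → Module (U ∪ K)
  ∪-module mU mK ux kx (inj₁ uy) (inj₁ uz) ¬v e = mU uy uz (¬v ∘ inj₁) e
  ∪-module mU mK ux kx (inj₁ uy) (inj₂ kz) ¬v e = mK kx kz (¬v ∘ inj₂) (mU uy ux (¬v ∘ inj₁) e)
  ∪-module mU mK ux kx (inj₂ ky) (inj₁ uz) ¬v e = mU ux uz (¬v ∘ inj₁) (mK ky kx (¬v ∘ inj₂) e)
  ∪-module mU mK ux kx (inj₂ ky) (inj₂ kz) ¬v e = mK ky kz (¬v ∘ inj₂) e

  no-P4-∪-starting-inˡ : ∀ {X Y a b c d} → Module X → P4Free X → Module Y → P4Free Y →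
                         X a → (X ∪ Y) b → (X ∪ Y) c → ¬ InducedP4 Γ a b c d
  no-P4-∪-starting-inˡ {X} {b = b} {c} {d} mX fX mY fY xa ub uc p =
    P4Free-module-∌-middle mY fY p
      (disjunctive-syllogism ub (X∌ ∘ inj₁) , disjunctive-syllogism uc (X∌ ∘ inj₂ ∘ inj₁))
    where
    X∌ : ¬ (X b ⊎ X c ⊎ X d)
    X∌ = P4Free-module-∋-end⇒∌-rest mX fX p xa

  ∪-P4Free : ∀ {X Y} → Module X → P4Free X → Module Y → P4Free Y → P4Free (X ∪ Y)
  ∪-P4Free mX fX mY fY (inj₁ xa) ub uc _ = no-P4-∪-starting-inˡ mX fX mY fY xa ub uc
  ∪-P4Free mX fX mY fY (inj₂ ya) ub uc _ = no-P4-∪-starting-inˡ mY fY mX fX ya (swap ub) (swap uc)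

  Isolates : Pred (Fin n) 0ℓ → Fin n → Fin n → Fin n → Fin n → Set
  Isolates U a b c d = Module U × U a × ¬ (U b ⊎ U c ⊎ U d)

  isolates-singleton : ∀ {a b c d} → InducedP4 Γ a b c d → Isolates (_≡ a) a b c d
  isolates-singleton {a} (ab , bc , cd , ¬ac , ¬bd , ¬ad) = singleton-module , refl , λ where
      (inj₁ refl)        → irrefl Γ a ab
      (inj₂ (inj₁ refl)) → ¬ad cd
      (inj₂ (inj₂ refl)) → ¬ac (sym Γ cd)
    where
    singleton-module : Module (_≡ a)
    singleton-module refl refl _ e = e

  isolates-∪ : ∀ {U K a b c d x} → InducedP4 Γ a b c d → Isolates U a b c d →
               Module K → P4Free K → U x → K x → Isolates (U ∪ K) a b c d
  isolates-∪ {U} {K} p (mU , ua , U∌) mK fK ux kx = U∪K-module , inj₁ ua , λ rest →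
      module-∋-end⇒middle U∪K-module p (inj₁ ua) rest λ (ub , uc) →
      P4Free-module-∌-middle mK fK p
        (disjunctive-syllogism ub (U∌ ∘ inj₁) , disjunctive-syllogism uc (U∌ ∘ inj₂ ∘ inj₁))
    where
    U∪K-module : Module (U ∪ K)
    U∪K-module = ∪-module mU mK ux kx

  module _ {Π : PRel n} (Π-equiv : IsEquivalence Π) where
    open IsEquivalence Π-equiv renaming (refl to Π-refl; sym to Π-sym; trans to Π-trans)

    class-isModule : Homogeneous (E Γ) Π → ∀ x → Module (Π x)
    class-isModule hom x {v} xy xz ¬xv vy =
      hom v _ v _ Π-refl (Π-trans (Π-sym xy) xz) (λ vy′ → ¬xv (Π-trans xy (Π-sym vy′))) vy

    class-P4Free : P4FreeParts Π → ∀ x → P4Free (Π x)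
    class-P4Free cog x xa xb xc xd =
      cog _ _ _ _ (Π-trans (Π-sym xa) xb) (Π-trans (Π-sym xa) xc) (Π-trans (Π-sym xa) xd)

    modular⇒homogeneous : ModularParts Π → Homogeneous (E Γ) Π
    modular⇒homogeneous mod x y x′ y′ xx′ yy′ ¬xy e =
      mod yy′ (λ yx′ → ¬xy (Π-trans xx′ (Π-sym yx′))) (sym Γ (mod xx′ ¬xy (sym Γ e)))

  module JoinOfSiblings {Π₁ Π₂ : PRel n} (eq₁ : IsEquivalence Π₁) (eq₂ : IsEquivalence Π₂)
                        (sib₁ : Sibling Γ Π₁) (sib₂ : Sibling Γ Π₂) where

    J : PRel n
    J = Join Π₁ Π₂

    record Link (x y : Fin n) : Set₁ where
      field
        part        : Pred (Fin n) 0ℓ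
        part-module : Module part
        part-P4Free : P4Free part
        part-∋x     : part x
        part-∋y     : part y
        part-⊆J     : ∀ {z} → part z → J x z

    class-link : ∀ {Π x y} → IsEquivalence Π → Sibling Γ Π → (∀ {u v} → Π u v → J u v) →
                 Π x y → Link x y
    class-link {Π} {x} eq (cog , hom) Π⇒J xy = record
      { part        = Π x
      ; part-module = class-isModule eq hom x
      ; part-P4Free = class-P4Free eq cog x
      ; part-∋x     = IsEquivalence.refl eq
      ; part-∋y     = xy
      ; part-⊆J     = Π⇒J
      }

    link : ∀ {x y} → SymClosure (λ u v → Π₁ u v ⊎ Π₂ u v) x y → Link x y
    link (fwd (inj₁ xy)) = class-link eq₁ sib₁ (return ∘ fwd ∘ inj₁) xy
    link (fwd (inj₂ xy)) = class-link eq₂ sib₂ (return ∘ fwd ∘ inj₂) xy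
    link (bwd (inj₁ yx)) = class-link eq₁ sib₁ (return ∘ fwd ∘ inj₁) (IsEquivalence.sym eq₁ yx)
    link (bwd (inj₂ yx)) = class-link eq₂ sib₂ (return ∘ fwd ∘ inj₂) (IsEquivalence.sym eq₂ yx)

    isolated-along : ∀ {U a b c d x y} → InducedP4 Γ a b c d → Isolates U a b c d →
                     U x → J x y → y ≢ b
    isolated-along p (_ , _ , U∌) ux ε refl = U∌ (inj₁ ux)
    isolated-along p I ux (s ◅ r) =
      isolated-along p (isolates-∪ p I part-module part-P4Free ux part-∋x) (inj₂ part-∋y) r
      where open Link (link s)

    J-P4FreeParts : P4FreeParts J
    J-P4FreeParts a b c d ab _ _ p = isolated-along p (isolates-singleton p) refl ab refl

    J-modular : ModularParts J
    J-modular ε ¬pv e = e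
    J-modular (s ◅ r) ¬pv e =
      J-modular r (¬pv ∘ (s ◅_)) (part-module part-∋x part-∋y (¬pv ∘ part-⊆J) e)
      where open Link (link s)

    Join-sibling : Sibling Γ J
    Join-sibling = J-P4FreeParts , modular⇒homogeneous (EqClosure.isEquivalence _) J-modular

≐-refl : ∀ {n} {Π : PRel n} → Π ≐ Π
≐-refl = (λ _ _ q → q) , (λ _ _ q → q)

Merge? : ∀ {n} {Π : PRel n} → Decidable Π → ∀ x y → Decidable (Merge Π x y)
Merge? Π? x y a b = Π? a b ⊎-dec (Π? a x ×-dec Π? b y) ⊎-dec (Π? a y ×-dec Π? b x)

separatedPairs : ∀ {n} {Π : PRel n} → Decidable Π → ℕ
separatedPairs {n} Π? =
  length (filter (λ (a , b) → ¬? (Π? a b)) (cartesianProduct (allFin n) (allFin n)))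

Merge-separatedPairs-< : ∀ {n} {Π : PRel n} → Reflexive Π → (Π? : Decidable Π) → ∀ {x y} →
                         ¬ Π x y → separatedPairs (Merge? Π? x y) < separatedPairs Π?
Merge-separatedPairs-< Π-refl Π? {x} {y} ¬xy =
  filter-length-< _ _ (λ ¬m ab → ¬m (inj₁ ab))
    (∈-cartesianProduct⁺ (∈-allFin x) (∈-allFin y)) ¬xy
    (λ ¬m → ¬m (inj₂ (inj₁ (Π-refl , Π-refl))))

module Merging {n} {Π : PRel n} (Π-equiv : IsEquivalence Π) (x y : Fin n) where
  open IsEquivalence Π-equiv renaming (refl to Π-refl; sym to Π-sym; trans to Π-trans)

  XY : Pred (Fin n) 0ℓ
  XY = Π x ∪ Π y

  XY-closed : ∀ {a b} → XY a → Π a b → XY b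
  XY-closed (inj₁ xa) ab = inj₁ (Π-trans xa ab)
  XY-closed (inj₂ ya) ab = inj₂ (Π-trans ya ab)

  Merge⇒ : ∀ {a b} → Merge Π x y a b → Π a b ⊎ (XY a × XY b)
  Merge⇒ (inj₁ ab)               = inj₁ ab
  Merge⇒ (inj₂ (inj₁ (ax , by))) = inj₂ (inj₁ (Π-sym ax) , inj₂ (Π-sym by))
  Merge⇒ (inj₂ (inj₂ (ay , bx))) = inj₂ (inj₂ (Π-sym ay) , inj₁ (Π-sym bx))

  Merge⇐ : ∀ {a b} → XY a → XY b → Merge Π x y a b
  Merge⇐ (inj₁ xa) (inj₁ xb) = inj₁ (Π-trans (Π-sym xa) xb)
  Merge⇐ (inj₁ xa) (inj₂ yb) = inj₂ (inj₁ (Π-sym xa , Π-sym yb))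
  Merge⇐ (inj₂ ya) (inj₁ xb) = inj₂ (inj₂ (Π-sym ya , Π-sym xb))
  Merge⇐ (inj₂ ya) (inj₂ yb) = inj₁ (Π-trans (Π-sym ya) yb)

  Merge-from-XY : ∀ {a b} → XY a → Merge Π x y a b → XY b
  Merge-from-XY xya m with Merge⇒ m
  ... | inj₁ ab        = XY-closed xya ab
  ... | inj₂ (_ , xyb) = xyb

  Merge-outside-XY : ∀ {a b} → ¬ XY a → Merge Π x y a b → Π a b
  Merge-outside-XY ¬xya m = fromInj₁ (λ (xya , _) → contradiction xya ¬xya) (Merge⇒ m)

  Merge-isEquivalence : IsEquivalence (Merge Π x y)
  Merge-isEquivalence = record { refl = inj₁ Π-refl ; sym = M-sym ; trans = M-trans }
    where
    M-sym : ∀ {a b} → Merge Π x y a b → Merge Π x y b a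
    M-sym m with Merge⇒ m
    ... | inj₁ ab          = inj₁ (Π-sym ab)
    ... | inj₂ (xya , xyb) = Merge⇐ xyb xya

    M-trans : ∀ {a b c} → Merge Π x y a b → Merge Π x y b c → Merge Π x y a c
    M-trans m m′ with Merge⇒ m | Merge⇒ m′
    ... | inj₁ ab          | inj₁ bc          = inj₁ (Π-trans ab bc)
    ... | inj₁ ab          | inj₂ (xyb , xyc) = Merge⇐ (XY-closed xyb (Π-sym ab)) xyc
    ... | inj₂ (xya , xyb) | inj₁ bc          = Merge⇐ xya (XY-closed xyb bc)
    ... | inj₂ (xya , _)   | inj₂ (_ , xyc)   = Merge⇐ xya xyc

module _ {n : ℕ} (Γ : Graph n) where

  E⇒QAdj : ∀ {Π} → Reflexive Π → ∀ {z w} → E Γ z w → QAdj Γ Π z w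
  E⇒QAdj Π-refl e = _ , _ , Π-refl , Π-refl , e

  module _ {Π : PRel n} (Π-equiv : IsEquivalence Π) (hom : Homogeneous (E Γ) Π) where
    open IsEquivalence Π-equiv renaming (refl to Π-refl; sym to Π-sym; trans to Π-trans)

    QAdj⇒E : ∀ {z w} → ¬ Π z w → QAdj Γ Π z w → E Γ z w
    QAdj⇒E {z} {w} ¬zw (z′ , w′ , zz′ , ww′ , e) =
      hom z′ w′ z w (Π-sym zz′) (Π-sym ww′)
        (λ z′w′ → ¬zw (Π-trans zz′ (Π-trans z′w′ (Π-sym ww′)))) e

    QTwins⇒common-neighbour : ∀ {x y v} → QTwins Γ Π x y → ¬ Π v x → ¬ Π v y →
                              E Γ v x → E Γ v y
    QTwins⇒common-neighbour (_ , twin) ¬vx ¬vy e =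
      QAdj⇒E ¬vy (proj₁ (twin _ ¬vx ¬vy) (E⇒QAdj Π-refl e))

    QTwins-sym : ∀ {x y} → QTwins Γ Π x y → QTwins Γ Π y x
    QTwins-sym (¬xy , twin) =
      ¬xy ∘ Π-sym , λ z ¬zy ¬zx → let (x⇒y , y⇒x) = twin z ¬zx ¬zy in y⇒x , x⇒y

  module MergeOfTwins {Π : PRel n} (Π-equiv : IsEquivalence Π) (Π? : Decidable Π)
                      (sib : Sibling Γ Π) {x y : Fin n} (tw : QTwins Γ Π x y) where
    open IsEquivalence Π-equiv using () renaming (refl to Π-refl; sym to Π-sym)
    open Merging Π-equiv x y

    private
      hom : Homogeneous (E Γ) Π
      hom = proj₂ sib

      class-module : ∀ z → Module Γ (Π z)
      class-module = class-isModule Γ Π-equiv hom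

      class-cograph : ∀ z → P4Free Γ (Π z)
      class-cograph = class-P4Free Γ Π-equiv (proj₁ sib)

    edge-to-x : ∀ {u v} → XY u → ¬ XY v → E Γ v u → E Γ v x
    edge-to-x (inj₁ xu) ¬v e = class-module x xu Π-refl (¬v ∘ inj₁) e
    edge-to-x (inj₂ yu) ¬v e =
      QTwins⇒common-neighbour Π-equiv hom (QTwins-sym Π-equiv hom tw)
        (¬v ∘ inj₂ ∘ Π-sym) (¬v ∘ inj₁ ∘ Π-sym) (class-module y yu Π-refl (¬v ∘ inj₂) e)

    edge-from-x : ∀ {u v} → XY u → ¬ XY v → E Γ v x → E Γ v u
    edge-from-x (inj₁ xu) ¬v e = class-module x Π-refl xu (¬v ∘ inj₁) e
    edge-from-x (inj₂ yu) ¬v e =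
      class-module y Π-refl yu (¬v ∘ inj₂)
        (QTwins⇒common-neighbour Π-equiv hom tw (¬v ∘ inj₁ ∘ Π-sym) (¬v ∘ inj₂ ∘ Π-sym) e)

    XY-module : Module Γ XY
    XY-module xyu xyu′ ¬v e = edge-from-x xyu′ ¬v (edge-to-x xyu ¬v e)

    Merge-modular : ModularParts Γ (Merge Π x y)
    Merge-modular {p} pp′ ¬pv e with Merge⇒ pp′
    ... | inj₁ Πpp′         = class-module p Π-refl Πpp′ (¬pv ∘ inj₁) e
    ... | inj₂ (xyp , xyp′) = XY-module xyp xyp′ (¬pv ∘ Merge⇐ xyp) e

    Merge-P4FreeParts : P4FreeParts Γ (Merge Π x y)
    Merge-P4FreeParts a b c d ab ac ad with Π? x a ⊎-dec Π? y a
    ... | yes xya =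
      ∪-P4Free Γ (class-module x) (class-cograph x) (class-module y) (class-cograph y)
        xya (Merge-from-XY xya ab) (Merge-from-XY xya ac) (Merge-from-XY xya ad)
    ... | no ¬xya =
      proj₁ sib a b c d
        (Merge-outside-XY ¬xya ab) (Merge-outside-XY ¬xya ac) (Merge-outside-XY ¬xya ad)

    Merge-sibling : Sibling Γ (Merge Π x y)
    Merge-sibling = Merge-P4FreeParts , modular⇒homogeneous Γ Merge-isEquivalence Merge-modular

  SiblingPartition : PRel n → Set
  SiblingPartition Π = IsPartition Π × Sibling Γ Π

  singletons-siblingPartition : SiblingPartition _≡_
  singletons-siblingPartition =
    (isEquivalence , _≟_) ,
    (λ where a _ _ _ refl refl refl (aa , _) → irrefl Γ a aa) ,
    (λ where _ _ _ _ refl refl _ e → e)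

  SiblingPartition-≐ : ∀ {Π Π′} → Π′ ≐ Π → SiblingPartition Π → SiblingPartition Π′
  SiblingPartition-≐ {Π} {Π′} (to , from) ((Π-equiv , Π?) , cog , hom) =
    (Π′-equiv , λ a b → map′ (from a b) (to a b) (Π? a b)) ,
    (λ a b c d ab ac ad → cog a b c d (to _ _ ab) (to _ _ ac) (to _ _ ad)) ,
    (λ x y x′ y′ xx′ yy′ ¬xy → hom x y x′ y′ (to _ _ xx′) (to _ _ yy′) (¬xy ∘ from _ _))
    where
    open IsEquivalence Π-equiv renaming (refl to Π-refl; sym to Π-sym; trans to Π-trans)

    Π′-equiv : IsEquivalence Π′
    Π′-equiv = record
      { refl  = from _ _ Π-refl
      ; sym   = λ q → from _ _ (Π-sym (to _ _ q))
      ; trans = λ q r → from _ _ (Π-trans (to _ _ q) (to _ _ r))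
      }

  Merge-siblingPartition : ∀ {Π x y} → SiblingPartition Π → QTwins Γ Π x y →
                           SiblingPartition (Merge Π x y)
  Merge-siblingPartition {x = x} {y} ((Π-equiv , Π?) , sib) tw =
    (Merging.Merge-isEquivalence Π-equiv x y , Merge? Π? x y) ,
    MergeOfTwins.Merge-sibling Π-equiv Π? sib tw

  reduction-preserves-siblingPartition : ∀ {Π Π′} → Star (TRStep Γ) Π Π′ →
                                         SiblingPartition Π → SiblingPartition Π′
  reduction-preserves-siblingPartition ε sp = sp
  reduction-preserves-siblingPartition ((_ , _ , tw , Π′≐Merge) ◅ steps) sp =
    reduction-preserves-siblingPartition steps
      (SiblingPartition-≐ Π′≐Merge (Merge-siblingPartition sp tw))

  QTwins? : ∀ {Π} → Decidable Π → Decidable (QTwins Γ Π)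
  QTwins? {Π} Π? x y =
    ¬? (Π? x y) ×-dec all? λ z → ¬? (Π? z x) →-dec ¬? (Π? z y) →-dec
      ((QAdj? z x →-dec QAdj? z y) ×-dec (QAdj? z y →-dec QAdj? z x))
    where
    QAdj? : ∀ z w → Dec (QAdj Γ Π z w)
    QAdj? z w = any? λ z′ → any? λ w′ → Π? z z′ ×-dec Π? w w′ ×-dec dec Γ z′ w′

  TwinReduced : PRel n → Set₁
  TwinReduced Π = SiblingPartition Π × Reachable Γ Π × TwinFree Γ Π

  twin-reduction : ∀ {Π} (sp : SiblingPartition Π) → Reachable Γ Π →
                   Acc _<_ (separatedPairs (proj₂ (proj₁ sp))) → ∃ TwinReduced
  twin-reduction sp@((Π-equiv , Π?) , _) reachable (acc rs) with any? (λ x → any? (QTwins? Π? x))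
  ... | no ¬tw = _ , sp , reachable , λ x y tw → ¬tw (x , y , tw)
  ... | yes (x , y , tw) =
    twin-reduction (Merge-siblingPartition sp tw) (reachable ◅◅ return (x , y , tw , ≐-refl))
      (rs (Merge-separatedPairs-< (IsEquivalence.refl Π-equiv) Π? (proj₁ tw)))

module Cographs {n : ℕ} {_≈_ : Rel (Fin n) 0ℓ} (≈-equiv : IsEquivalence _≈_)
                (_≈?_ : Decidable _≈_) where
  open IsEquivalence ≈-equiv renaming (refl to ≈-refl; sym to ≈-sym; trans to ≈-trans)

  -- A graph on the ≈-classes of Fin n: adjacency is only meaningful between vertices of
  -- distinct classes, where it does not depend on the representatives.
  record ClassGraph : Set₁ where
    field
      _~_           : Rel (Fin n) 0ℓ
      ~-sym         : Symmetric _~_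
      _~?_          : Decidable _~_
      ~-homogeneous : Homogeneous _~_ _≈_

  data Connection : Set where
    disjoint complete : Connection

  opposite : Connection → Connection
  opposite disjoint = complete
  opposite complete = disjoint

  module _ (g : ClassGraph) where
    open ClassGraph g

    Linked : Connection → Rel (Fin n) 0ℓ
    Linked disjoint a b = ¬ a ~ b
    Linked complete a b = a ~ b

    linked? : ∀ a b → ∃ λ t → Linked t a b
    linked? a b with a ~? b
    ... | yes ab = complete , ab
    ... | no ¬ab = disjoint , ¬ab

    Linked-sym : ∀ {t a b} → Linked t a b → Linked t b a
    Linked-sym {disjoint} ¬ab ba = ¬ab (~-sym ba)
    Linked-sym {complete} ab     = ~-sym ab

    Linked-resp : ∀ {t a a′ b b′} → a ≈ a′ → b ≈ b′ → ¬ a ≈ b → Linked t a b → Linked t a′ b′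
    Linked-resp {disjoint} aa′ bb′ a≉b ¬ab a′b′ =
      ¬ab (~-homogeneous _ _ _ _ (≈-sym aa′) (≈-sym bb′)
            (λ a′≈b′ → a≉b (≈-trans aa′ (≈-trans a′≈b′ (≈-sym bb′)))) a′b′)
    Linked-resp {complete} aa′ bb′ a≉b ab = ~-homogeneous _ _ _ _ aa′ bb′ a≉b ab

    Linked-transfer : ∀ {t u v z} → Linked t u z → Linked t v z → z ~ u → z ~ v
    Linked-transfer {disjoint} ¬uz _  zu = contradiction (~-sym zu) ¬uz
    Linked-transfer {complete} _   vz _  = ~-sym vz

    complement : ClassGraph
    complement = record
      { _~_           = Linked disjoint
      ; ~-sym         = Linked-sym {disjoint}
      ; _~?_          = λ a b → ¬? (a ~? b)
      ; ~-homogeneous = λ _ _ _ _ → Linked-resp {disjoint}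
      }

  Linked-complement⇒ : ∀ {g t a b} → Linked (complement g) t a b → Linked g (opposite t) a b
  Linked-complement⇒ {g} {disjoint} = decidable-stable (_ ~? _) where open ClassGraph g
  Linked-complement⇒ {g} {complete} ¬ab = ¬ab

  Linked-complement⇐ : ∀ {g t a b} → Linked g t a b → Linked (complement g) (opposite t) a b
  Linked-complement⇐ {g} {disjoint} ¬ab = ¬ab
  Linked-complement⇐ {g} {complete} ab ¬ab = ¬ab ab

  record Subset : Set₁ where
    infix 4 _∋_ _∋?_
    field
      _∋_  : Fin n → Set
      _∋?_ : ∀ x → Dec (_∋_ x)
  open Subset

  infix 4 _⊆_
  infixl 6 _∩_ _∖_

  _⊆_ : Subset → Subset → Set
  A ⊆ W = ∀ {z} → A ∋ z → W ∋ z

  _∩_ : Subset → Subset → Subset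
  W ∩ C = record { _∋_ = λ z → W ∋ z × C ∋ z ; _∋?_ = λ z → W ∋? z ×-dec C ∋? z }

  _∖_ : Subset → Subset → Subset
  W ∖ C = record { _∋_ = λ z → W ∋ z × ¬ C ∋ z ; _∋?_ = λ z → W ∋? z ×-dec ¬? (C ∋? z) }

  class : Fin n → Subset
  class x = record { _∋_ = _≈ x ; _∋?_ = _≈? x }

  size : Subset → ℕ
  size W = length (filter (W ∋?_) (allFin n))

  size-< : ∀ {A W z} → A ⊆ W → W ∋ z → ¬ A ∋ z → size A < size W
  size-< {A} {W} {z} A⊆W wz ¬az = filter-length-< (A ∋?_) (W ∋?_) A⊆W (∈-allFin z) wz ¬az

  Nontrivial : Subset → Set
  Nontrivial W = ∃[ u ] ∃[ v ] (W ∋ u × W ∋ v × ¬ u ≈ v)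

  nontrivial? : ∀ W → Dec (Nontrivial W)
  nontrivial? W = any? λ u → any? λ v → W ∋? u ×-dec W ∋? v ×-dec ¬? (u ≈? v)

  trivial⇒≈ : ∀ {W u v} → ¬ Nontrivial W → W ∋ u → W ∋ v → u ≈ v
  trivial⇒≈ {u = u} {v} trivial wu wv =
    decidable-stable (u ≈? v) λ u≉v → trivial (u , v , wu , wv , u≉v)

  Closed : Subset → Subset → Set
  Closed C W = ∀ {c w} → C ∋ c → W ∋ w → c ≈ w → C ∋ w

  module _ (g : ClassGraph) where
    open ClassGraph g

    Cograph : Subset → Set
    Cograph W = ∀ {a b c d} → W ∋ a → W ∋ b → W ∋ c → W ∋ d →
                ¬ (a ~ b × b ~ c × c ~ d × ¬ a ~ c × ¬ b ~ d × ¬ a ~ d)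

    Cograph-⊆ : ∀ {A W} → A ⊆ W → Cograph W → Cograph A
    Cograph-⊆ A⊆W cograph wa wb wc wd = cograph (A⊆W wa) (A⊆W wb) (A⊆W wc) (A⊆W wd)

  Cograph-complement : ∀ {g W} → Cograph g W → Cograph (complement g) W
  Cograph-complement {g} cograph wa wb wc wd (¬ab , ¬bc , ¬cd , ¬¬ac , ¬¬bd , ¬¬ad) =
    cograph wc wa wd wb
      (~-sym (stable ¬¬ac) , stable ¬¬ad , ~-sym (stable ¬¬bd) , ¬cd , ¬ab , ¬bc ∘ ~-sym)
    where
    open ClassGraph g
    stable : ∀ {a b} → ¬ ¬ a ~ b → a ~ b
    stable = decidable-stable (_ ~? _)

  record Decomposition (g : ClassGraph) (W : Subset) (t : Connection) : Set₁ where
    field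
      A B       : Subset
      A⊆W       : A ⊆ W
      B⊆W       : B ⊆ W
      cover     : ∀ {z} → W ∋ z → A ∋ z ⊎ B ∋ z
      separated : ∀ {a b} → A ∋ a → B ∋ b → ¬ a ≈ b
      A-witness : ∃ (A ∋_)
      B-witness : ∃ (B ∋_)
      linked    : ∀ {a b} → A ∋ a → B ∋ b → Linked g t a b

    A-closed : Closed A W
    A-closed aa ww a≈w with cover ww
    ... | inj₁ aw = aw
    ... | inj₂ bw = contradiction a≈w (separated aa bw)

    A-smaller : size A < size W
    A-smaller = size-< A⊆W (B⊆W (proj₂ B-witness)) λ ab → separated ab (proj₂ B-witness) ≈-refl

  swapᴰ : ∀ {g W t} → Decomposition g W t → Decomposition g W t
  swapᴰ {g} {t = t} D = record
    { A = B ; B = A ; A⊆W = B⊆W ; B⊆W = A⊆W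
    ; cover     = swap ∘ cover
    ; separated = λ bb aa b≈a → separated aa bb (≈-sym b≈a)
    ; A-witness = B-witness ; B-witness = A-witness
    ; linked    = λ bb aa → Linked-sym g {t} (linked aa bb)
    }
    where open Decomposition D

  toComplement : ∀ {g W t} → Decomposition g W t → Decomposition (complement g) W (opposite t)
  toComplement {g} {t = t} D =
    record { Decomposition D ; linked = λ aa bb → Linked-complement⇐ {g} {t} (linked aa bb) }
    where open Decomposition D

  fromComplement : ∀ {g W t} → Decomposition (complement g) W t → Decomposition g W (opposite t)
  fromComplement {g} {t = t} D =
    record { Decomposition D ; linked = λ aa bb → Linked-complement⇒ {g} {t} (linked aa bb) }
    where open Decomposition D

  split-off : ∀ {g W t} (C : Subset) → C ⊆ W → Closed C W → ∃ (C ∋_) → ∃ (W ∖ C ∋_) →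
              (∀ {a b} → C ∋ a → W ∖ C ∋ b → Linked g t a b) → Decomposition g W t
  split-off {W = W} C C⊆W C-closed C-witness rest-witness C-linked = record
    { A = C ; B = W ∖ C ; A⊆W = C⊆W ; B⊆W = proj₁
    ; cover     = λ {z} wz → map₂ (wz ,_) (toSum (C ∋? z))
    ; separated = λ cc (ww , ¬cw) c≈w → ¬cw (C-closed cc ww c≈w)
    ; A-witness = C-witness ; B-witness = rest-witness
    ; linked    = C-linked
    }

  split-off-class : ∀ {g W x t} → W ∋ x → ∃ (W ∖ class x ∋_) →
                    (∀ {w} → W ∖ class x ∋ w → Linked g t x w) → Decomposition g W t
  split-off-class {g} {W} {x} {t} wx (v , wv , v≉x) x-linked =
    split-off (W ∩ class x) proj₁ closed (x , wx , ≈-refl) (v , wv , v≉x ∘ proj₂) C-linked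
    where
    closed : Closed (W ∩ class x) W
    closed (_ , c≈x) ww c≈w = ww , ≈-trans (≈-sym c≈w) c≈x

    C-linked : ∀ {a b} → W ∩ class x ∋ a → W ∖ (W ∩ class x) ∋ b → Linked g t a b
    C-linked {b = b} (_ , a≈x) (wb , ¬b) =
      Linked-resp g {t} (≈-sym a≈x) ≈-refl (b≉x ∘ ≈-sym) (x-linked (wb , b≉x))
      where
      b≉x : ¬ b ≈ x
      b≉x b≈x = ¬b (wb , b≈x)

  -- Adding x to W ∖ [x] = A ∪ B (no edges between A and B), where x misses some y ∈ A. If an
  -- edge of A joins a neighbour of x to a non-neighbour, x misses all of B (else there is a
  -- P4), so B splits off; otherwise the non-neighbours of x in A split off.
  module Extension (g : ClassGraph) {W : Subset} (cograph : Cograph g W) {x : Fin n} (wx : W ∋ x)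
                   (D : Decomposition g (W ∖ class x) disjoint) where
    open ClassGraph g
    open Decomposition D

    x∉A : ¬ A ∋ x
    x∉A ax = proj₂ (A⊆W ax) ≈-refl

    x∉B : ¬ B ∋ x
    x∉B bx = proj₂ (B⊆W bx) ≈-refl

    closed-in-W : ∀ {C} → C ⊆ W ∖ class x → Closed C (W ∖ class x) → Closed C W
    closed-in-W C⊆W′ C-closed cc ww c≈w =
      C-closed cc (ww , λ w≈x → proj₂ (C⊆W′ cc) (≈-trans c≈w w≈x)) c≈w

    Bridge : Set
    Bridge = ∃[ y₁ ] ∃[ y₂ ] (A ∋ y₁ × A ∋ y₂ × x ~ y₁ × ¬ x ~ y₂ × y₁ ~ y₂)

    bridge? : Dec Bridge
    bridge? = any? λ y₁ → any? λ y₂ →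
      A ∋? y₁ ×-dec A ∋? y₂ ×-dec x ~? y₁ ×-dec ¬? (x ~? y₂) ×-dec y₁ ~? y₂

    bridge⇒x-B-disjoint : Bridge → ∀ {z} → B ∋ z → ¬ x ~ z
    bridge⇒x-B-disjoint (y₁ , y₂ , ay₁ , ay₂ , xy₁ , ¬xy₂ , y₁y₂) bz xz =
      cograph (proj₁ (A⊆W ay₂)) (proj₁ (A⊆W ay₁)) wx (proj₁ (B⊆W bz))
        (~-sym y₁y₂ , ~-sym xy₁ , xz , ¬xy₂ ∘ ~-sym , linked ay₁ bz , linked ay₂ bz)

    split-off-B : (∀ {z} → B ∋ z → ¬ x ~ z) → Decomposition g W disjoint
    split-off-B x-B-disjoint =
      split-off B (proj₁ ∘ B⊆W) (closed-in-W {B} B⊆W B-closed) B-witness (x , wx , x∉B) B-linked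
      where
      B-closed : Closed B (W ∖ class x)
      B-closed = Decomposition.A-closed (swapᴰ D)

      B-linked : ∀ {b w} → B ∋ b → W ∖ B ∋ w → ¬ b ~ w
      B-linked {b} {w} bb (ww , ¬bw) with w ≈? x
      ... | yes w≈x = Linked-resp g {disjoint} ≈-refl (≈-sym w≈x) (proj₂ (B⊆W bb))
                        (x-B-disjoint bb ∘ ~-sym)
      ... | no w≉x with cover (ww , w≉x)
      ...   | inj₁ aw = Linked-sym g {disjoint} (linked aw bb)
      ...   | inj₂ bw = contradiction bw ¬bw

    split-off-non-neighbours : ¬ Bridge → ∀ {y} → A ∋ y → ¬ x ~ y → Decomposition g W disjoint
    split-off-non-neighbours ¬bridge {y} ay ¬xy =
      split-off M (proj₁ ∘ A⊆W ∘ proj₁) M-closed (y , ay , ¬xy) (x , wx , x∉A ∘ proj₁) M-linked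
      where
      M : Subset
      M = A ∖ record { _∋_ = x ~_ ; _∋?_ = x ~?_ }

      M-closed : Closed M W
      M-closed (am , ¬xm) ww m≈w =
        closed-in-W {A} A⊆W (Decomposition.A-closed D) am ww m≈w ,
        λ xw → ¬xm (Linked-resp g {complete} ≈-refl (≈-sym m≈w)
                      (λ x≈w → proj₂ (A⊆W am) (≈-trans m≈w (≈-sym x≈w))) xw)

      M-linked : ∀ {m w} → M ∋ m → W ∖ M ∋ w → ¬ m ~ w
      M-linked {m} {w} (am , ¬xm) (ww , ¬mw) with w ≈? x
      ... | yes w≈x = λ mw → ¬xm (~-sym (Linked-resp g {complete} ≈-refl w≈x
                                          (λ m≈w → proj₂ (A⊆W am) (≈-trans m≈w w≈x)) mw))
      ... | no w≉x with cover (ww , w≉x)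
      ...   | inj₂ bw = linked am bw
      ...   | inj₁ aw with x ~? w
      ...     | yes xw = λ mw → ¬bridge (w , m , aw , am , xw , ¬xm , ~-sym mw)
      ...     | no ¬xw = contradiction (aw , ¬xw) ¬mw

    extend-at : ∀ {y} → A ∋ y → ¬ x ~ y → Decomposition g W disjoint
    extend-at ay ¬xy with bridge?
    ... | yes bridge = split-off-B (bridge⇒x-B-disjoint bridge)
    ... | no ¬bridge = split-off-non-neighbours ¬bridge ay ¬xy

  extend-disjoint : ∀ g {W} → Cograph g W → ∀ {x} → W ∋ x →
                    Decomposition g (W ∖ class x) disjoint → ∃ (Decomposition g W)
  extend-disjoint g {W} cograph {x} wx D with any? (λ z → W ∖ class x ∋? z ×-dec ¬? (x ~? z))
    where open ClassGraph g
  ... | no ¬non-neighbour =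
    complete , split-off-class wx (_ , A⊆W (proj₂ A-witness))
                 λ w′w → decidable-stable (x ~? _) λ ¬xw → ¬non-neighbour (_ , w′w , ¬xw)
    where open ClassGraph g
          open Decomposition D
  ... | yes (y , w′y , ¬xy) with Decomposition.cover D w′y
  ...   | inj₁ ay = disjoint , Extension.extend-at g cograph wx D ay ¬xy
  ...   | inj₂ by = disjoint , Extension.extend-at g cograph wx (swapᴰ D) by ¬xy

  extend : ∀ g {W} → Cograph g W → ∀ {x} → W ∋ x →
           ∃ (Decomposition g (W ∖ class x)) → ∃ (Decomposition g W)
  extend g cograph wx (disjoint , D) = extend-disjoint g cograph wx D
  extend g {W} cograph wx (complete , D) =
    map opposite fromComplement
      (extend-disjoint (complement g) (Cograph-complement {g} {W} cograph) wx (toComplement D))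

  decompose : ∀ g W → Cograph g W → Nontrivial W → Acc _<_ (size W) → ∃ (Decomposition g W)
  decompose g W cograph (u , v , wu , wv , u≉v) (acc rs) with nontrivial? (W ∖ class u)
  ... | yes nontrivial′ =
    extend g cograph wu
      (decompose g (W ∖ class u) (Cograph-⊆ g {W ∖ class u} {W} proj₁ cograph) nontrivial′
         (rs (size-< {W ∖ class u} proj₁ wu λ (_ , u≉u) → u≉u ≈-refl)))
  ... | no trivial with linked? g u v
  ...   | t , uv =
    t , split-off-class wu (v , wv , u≉v ∘ ≈-sym) λ w′w →
          Linked-resp g {t} ≈-refl (trivial⇒≈ {W ∖ class u} trivial (wv , u≉v ∘ ≈-sym) w′w) u≉v uv

  module _ (g : ClassGraph) where
    open ClassGraph g

    SameNeighbours : Subset → Fin n → Fin n → Set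
    SameNeighbours W u v = ∀ {z} → W ∋ z → ¬ z ≈ u → ¬ z ≈ v → z ~ u → z ~ v

    Twins : Subset → Set
    Twins W =
      ∃[ u ] ∃[ v ] (W ∋ u × W ∋ v × ¬ u ≈ v × SameNeighbours W u v × SameNeighbours W v u)

    module _ {W t} (D : Decomposition g W t) where
      open Decomposition D

      SameNeighbours-lift : ∀ {u v} → A ∋ u → A ∋ v → SameNeighbours A u v →
                            SameNeighbours W u v
      SameNeighbours-lift au av same wz z≉u z≉v with cover wz
      ... | inj₁ az = same az z≉u z≉v
      ... | inj₂ bz = Linked-transfer g {t} (linked au bz) (linked av bz)

      Twins-lift : Twins A → Twins W
      Twins-lift (u , v , au , av , u≉v , uv , vu) =
        u , v , A⊆W au , A⊆W av , u≉v , SameNeighbours-lift au av uv , SameNeighbours-lift av au vu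

      trivial-parts⇒Twins : ¬ Nontrivial A → ¬ Nontrivial B → Twins W
      trivial-parts⇒Twins trivialA trivialB =
        a , b , A⊆W aa , B⊆W bb , separated aa bb ,
        (λ wz z≉a z≉b → ⊥-elim (no-third-class wz z≉a z≉b)) ,
        (λ wz z≉b z≉a → ⊥-elim (no-third-class wz z≉a z≉b))
        where
        a b : Fin n
        a = proj₁ A-witness
        b = proj₁ B-witness
        aa : A ∋ a
        aa = proj₂ A-witness
        bb : B ∋ b
        bb = proj₂ B-witness

        no-third-class : ∀ {z} → W ∋ z → ¬ z ≈ a → ¬ z ≈ b → ⊥
        no-third-class wz z≉a z≉b with cover wz
        ... | inj₁ az = z≉a (trivial⇒≈ {A} trivialA az aa)
        ... | inj₂ bz = z≉b (trivial⇒≈ {B} trivialB bz bb)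

  twins : ∀ g W → Cograph g W → Nontrivial W → Acc _<_ (size W) → Twins g W
  twins g W cograph nontrivial (acc rs) =
    twins-of (proj₂ (decompose g W cograph nontrivial (<-wellFounded (size W))))
    where
    twins-in-A : ∀ {t} (D : Decomposition g W t) → Nontrivial (Decomposition.A D) → Twins g W
    twins-in-A D nontrivialA =
      Twins-lift g D (twins g A (Cograph-⊆ g {A} {W} A⊆W cograph) nontrivialA (rs A-smaller))
      where open Decomposition D

    twins-of : ∀ {t} → Decomposition g W t → Twins g W
    twins-of D with nontrivial? (Decomposition.A D) | nontrivial? (Decomposition.B D)
    ... | yes nontrivialA | _               = twins-in-A D nontrivialA
    ... | no _            | yes nontrivialB = twins-in-A (swapᴰ D) nontrivialB
    ... | no trivialA     | no trivialB     = trivial-parts⇒Twins g D trivialA trivialB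

module _ {n : ℕ} (Γ : Graph n) where

  module _ {S : PRel n} (S-equiv : IsEquivalence S) (S-hom : Homogeneous (E Γ) S)
           {U : Pred (Fin n) 0ℓ} (U? : ∀ z → Dec (U z)) (U-module : Module Γ U) where

    SameNeighboursIn : Fin n → Fin n → Set
    SameNeighboursIn u v = ∀ {z} → U z → ¬ S z u → ¬ S z v → E Γ z u → E Γ z v

    QAdj-transfer : ∀ {u v} → U u → U v → SameNeighboursIn u v →
                    ∀ {z} → ¬ S z u → ¬ S z v → QAdj Γ S z u → QAdj Γ S z v
    QAdj-transfer {u} {v} uu uv same {z} ¬zu ¬zv =
      E⇒QAdj Γ (IsEquivalence.refl S-equiv) ∘ common-neighbour ∘ QAdj⇒E Γ S-equiv S-hom ¬zu
      where
      common-neighbour : E Γ z u → E Γ z v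
      common-neighbour with U? z
      ... | yes uz = same uz ¬zu ¬zv
      ... | no ¬uz = U-module uu uv ¬uz

    twins-in-module⇒QTwins : ∀ {u v} → U u → U v → ¬ S u v →
                             SameNeighboursIn u v → SameNeighboursIn v u → QTwins Γ S u v
    twins-in-module⇒QTwins uu uv ¬uv same-uv same-vu =
      ¬uv , λ z ¬zu ¬zv → QAdj-transfer uu uv same-uv ¬zu ¬zv , QAdj-transfer uv uu same-vu ¬zv ¬zu

  twin-free-coarsest : ∀ {S T} → SiblingPartition Γ S → TwinFree Γ S →
                       SiblingPartition Γ T → T ⊑ S
  twin-free-coarsest {S} {T} ((S-equiv , S?) , _ , S-hom) twin-free
                     ((T-equiv , T?) , T-cog , T-hom) x y Txy =
    decidable-stable (S? x y) λ ¬Sxy →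
      let (u , v , Tu , Tv , ¬Suv , same-uv , same-vu) =
            twins quotient part (class-P4Free Γ T-equiv T-cog x)
              (x , y , IsEquivalence.refl T-equiv , Txy , ¬Sxy) (<-wellFounded _)
      in twin-free u v
           (twins-in-module⇒QTwins S-equiv S-hom (T? x) (class-isModule Γ T-equiv T-hom x)
              Tu Tv ¬Suv same-uv same-vu)
    where
    open Cographs S-equiv S? using (ClassGraph; Subset; twins)

    quotient : ClassGraph
    quotient = record { _~_ = E Γ ; ~-sym = sym Γ ; _~?_ = dec Γ ; ~-homogeneous = S-hom }

    part : Subset
    part = record { _∋_ = T x ; _∋?_ = T? x }

mainTheorem2 : ∀ {n} (Γ : Graph n) →
    -- (i) the join of two sibling partitions is a sibling partition
    (∀ Π₁ Π₂ → IsPartition Π₁ → IsPartition Π₂ →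
       Sibling Γ Π₁ → Sibling Γ Π₂ → Sibling Γ (Join Π₁ Π₂))
    -- (ii) unique maximal sibling partition, equal to the output of
    -- complete twin reduction (which terminates, whatever the choices)
    × (Σ[ Π ∈ PRel n ]
         (IsPartition Π
          × MaximalSibling Γ Π
          × (∀ Σ' → IsPartition Σ' → MaximalSibling Γ Σ' → Σ' ≐ Π)
          × Reachable Γ Π × TwinFree Γ Π
          × (∀ Σ' → Reachable Γ Σ' → TwinFree Γ Σ' → Σ' ≐ Π)))
mainTheorem2 Γ with twin-reduction Γ (singletons-siblingPartition Γ) ε (<-wellFounded _)
... | Π , sp@(isPartition , sibling) , reachable , twin-free =
  join-sibling , Π , isPartition , (sibling , maximal) , unique-maximal ,
  reachable , twin-free , unique-reduced
  where
  join-sibling : ∀ Π₁ Π₂ → IsPartition Π₁ → IsPartition Π₂ →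
                 Sibling Γ Π₁ → Sibling Γ Π₂ → Sibling Γ (Join Π₁ Π₂)
  join-sibling _ _ (eq₁ , _) (eq₂ , _) = JoinOfSiblings.Join-sibling Γ eq₁ eq₂

  coarsest : ∀ {Π′} → SiblingPartition Γ Π′ → Π′ ⊑ Π
  coarsest = twin-free-coarsest Γ sp twin-free

  maximal : ∀ Π′ → IsPartition Π′ → Sibling Γ Π′ → Π ⊑ Π′ → Π′ ⊑ Π
  maximal _ isPartition′ sibling′ _ = coarsest (isPartition′ , sibling′)

  unique-maximal : ∀ Π′ → IsPartition Π′ → MaximalSibling Γ Π′ → Π′ ≐ Π
  unique-maximal Π′ isPartition′ (sibling′ , maximal′) =
    Π′⊑Π , maximal′ Π isPartition sibling Π′⊑Π
    where
    Π′⊑Π : Π′ ⊑ Π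
    Π′⊑Π = coarsest (isPartition′ , sibling′)

  unique-reduced : ∀ Π′ → Reachable Γ Π′ → TwinFree Γ Π′ → Π′ ≐ Π
  unique-reduced Π′ reachable′ twin-free′ =
    coarsest sp′ , twin-free-coarsest Γ sp′ twin-free′ sp
    where
    sp′ : SiblingPartition Γ Π′
    sp′ = reduction-preserves-siblingPartition Γ reachable′ (singletons-siblingPartition Γ)
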